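{- Let $d$ be an integer and $\alpha\ge1$ with $d>2\alpha$. Consider the following algorithm on an initially empty dynamic graph $G$ undergoing a sequence of edge insertions and deletions such that the arboricity of $G$ is at most $\alpha$ at all times. It maintains an orientation of $G$. On deletion of an edge, the edge is simply removed. On insertion of an edge $e$, an arbitrary endpoint $u$ of $e$ is chosen, $e$ is oriented away from $u$, and then every out-edge of $u$ (including $e$) is reversed, so that $u$ becomes a sink; afterwards, as long as some vertex $v$ has out-degree larger than $d$, all out-edges of $v$ are reversed. For every $s\ge 0$, let $G_s$ be $G$ after the first $s$ updates. Then the orientation $O_s$ of $G_s$ maintained by this algorithm is acyclic.
   Context: The arboricity of a graph is the minimum number of forests into which its edge set can be partitioned. An orientation is acyclic if it contains no directed cycle. (Under $d>2\alpha$ the reversal process after each insertion terminates.) -}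

module Defs where

open import Data.Nat using (ℕ; zero; suc; _+_; _≤_; _<_)
open import Data.Fin using (Fin; zero; suc; inject₁; fromℕ; _≟_)
open import Data.Bool using (Bool; true; false; _∧_; _∨_; not; if_then_else_)
open import Data.List using (List; []; _∷_; map; allFin)
open import Data.Nat.ListAction using (sum)
open import Data.Product using (Σ; _×_; _,_)
open import Data.Sum using (_⊎_)
open import Relation.Nullary using (¬_)
open import Relation.Nullary.Decidable using (⌊_⌋)
open import Relation.Binary.PropositionalEquality using (_≡_)
open import Relation.Binary.Construct.Closure.ReflexiveTransitive using (Star)
open import Function.Definitions using (Injective)

-- Undirected (simple) graph: E u v ≡ true iff {u,v} is an edge.
-- (All graphs below are built symmetric and loop-free.)
Graph : ℕ → Set
Graph n = Fin n → Fin n → Bool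

-- Orientation: O u v ≡ true iff there is an edge directed u → v.
Orientation : ℕ → Set
Orientation n = Fin n → Fin n → Bool

emptyO : ∀ {n} → Orientation n
emptyO _ _ = false

underlying : ∀ {n} → Orientation n → Graph n
underlying O u v = O u v ∨ O v u

isPair : ∀ {n} → Fin n → Fin n → Fin n → Fin n → Bool
isPair u v x y = (⌊ x ≟ u ⌋ ∧ ⌊ y ≟ v ⌋) ∨ (⌊ x ≟ v ⌋ ∧ ⌊ y ≟ u ⌋)

Cycle : ∀ {n} → Graph n → Set
Cycle {n} E = Σ ℕ λ k → Σ (Fin (suc (suc (suc k))) → Fin n) λ c →
  Injective _≡_ _≡_ c ×
  ((i : Fin (suc (suc k))) → E (c (inject₁ i)) (c (suc i)) ≡ true) ×
  (E (c (fromℕ (suc (suc k)))) (c zero) ≡ true)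

Forest : ∀ {n} → Graph n → Set
Forest E = ¬ Cycle E

-- Arboricity at most α: the edge set can be partitioned into α forests,
-- i.e. there is a colouring of the edges by Fin α (symmetric, so that it is
-- a colouring of unordered edges) whose colour classes are forests.
ArboricityAtMost : ∀ {n} → ℕ → Graph n → Set
ArboricityAtMost {n} α E = Σ (Fin n → Fin n → Fin α) λ col →
  ((u v : Fin n) → E u v ≡ true → col u v ≡ col v u) ×
  ((c : Fin α) → Forest (λ u v → E u v ∧ ⌊ col u v ≟ c ⌋))

DirCycle : ∀ {n} → Orientation n → Set
DirCycle {n} O = Σ ℕ λ k → Σ (Fin (suc k) → Fin n) λ c →
  Injective _≡_ _≡_ c ×
  ((i : Fin k) → O (c (inject₁ i)) (c (suc i)) ≡ true) ×
  (O (c (fromℕ k)) (c zero) ≡ true)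

Acyclic : ∀ {n} → Orientation n → Set
Acyclic O = ¬ DirCycle O

data Update (n : ℕ) : Set where
  ins : Fin n → Fin n → Update n
  del : Fin n → Fin n → Update n

-- A history is the list of updates performed so far, MOST RECENT FIRST.
History : ℕ → Set
History n = List (Update n)

applyUpdate : ∀ {n} → Update n → Graph n → Graph n
applyUpdate (ins u v) E x y = E x y ∨ isPair u v x y
applyUpdate (del u v) E x y = E x y ∧ not (isPair u v x y)

graphOf : ∀ {n} → History n → Graph n
graphOf [] _ _ = false
graphOf (up ∷ h) = applyUpdate up (graphOf h)

ValidUpdate : ∀ {n} → Graph n → Update n → Set
ValidUpdate E (ins u v) = ¬ (u ≡ v) × E u v ≡ false
ValidUpdate E (del u v) = E u v ≡ true

data GoodHistory {n : ℕ} (α : ℕ) : History n → Set where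
  []  : GoodHistory α []
  _∷_ : ∀ {h} up → GoodHistory α h →
        ValidUpdate (graphOf h) up →
        ArboricityAtMost α (graphOf (up ∷ h)) →
        GoodHistory α (up ∷ h)

-- The algorithm (nondeterministic: all choices are allowed).

outdeg : ∀ {n} → Orientation n → Fin n → ℕ
outdeg {n} O x = sum (map (λ y → if O x y then 1 else 0) (allFin n))

-- reverse all out-edges of v
flipAt : ∀ {n} → Fin n → Orientation n → Orientation n
flipAt v O x y = (O x y ∧ not ⌊ x ≟ v ⌋) ∨ (⌊ y ≟ v ⌋ ∧ O v x)

addArc : ∀ {n} → Fin n → Fin n → Orientation n → Orientation n
addArc u v O x y = O x y ∨ (⌊ x ≟ u ⌋ ∧ ⌊ y ≟ v ⌋)

removeEdge : ∀ {n} → Fin n → Fin n → Orientation n → Orientation n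
removeEdge u v O x y = O x y ∧ not (isPair u v x y)

data RepairStep {n : ℕ} (d : ℕ) : Orientation n → Orientation n → Set where
  repair : ∀ {O} v → d < outdeg O v → RepairStep d O (flipAt v O)

Repair : ∀ {n} → ℕ → Orientation n → Orientation n → Set
Repair {n} d O O' = Star (RepairStep d) O O' × ((v : Fin n) → outdeg O' v ≤ d)

data Process {n : ℕ} (d : ℕ) : Orientation n → Update n → Orientation n → Set where
  on-del : ∀ {O} u v → Process d O (del u v) (removeEdge u v O)
  on-ins : ∀ {O O'} u v w x →
           ((w ≡ u × x ≡ v) ⊎ (w ≡ v × x ≡ u)) →
           Repair d (flipAt w (addArc w x O)) O' →
           Process d O (ins u v) O'

data Run {n : ℕ} (d : ℕ) : History n → Orientation n → Set where
  start : Run d [] emptyO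
  next  : ∀ {h O O'} up → Run d h O → Process d O up O' → Run d (up ∷ h) O'

-- A directed cycle only follows arcs whose head has an out-arc, so an
-- operation whose only new arcs point into a sink cannot create a cycle.
-- Reversing all out-edges of a vertex v makes v a sink (as long as there is
-- no loop at v), and every other arc of the new orientation is an old one;
-- on insertion the fresh arc leaves the chosen endpoint, which is then made
-- a sink at once. Deletions only remove arcs.
module Submission where

open import Defs
open import Data.Nat using (ℕ; _*_; _<_; _≤_)
open import Data.Fin using (Fin; zero; suc; _≟_)
open import Data.Fin.Relation.Unary.Top using (view; ‵fromℕ; ‵inject₁)
open import Data.Bool using (true; false; _∨_)
open import Data.Bool.Properties using (∧-zeroʳ; ∧-conicalˡ)
open import Data.Product using (∃-syntax; _×_; _,_)
open import Data.Sum using (_⊎_; inj₁; inj₂)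
open import Function using (_∘_)
open import Relation.Nullary using (yes; no; contradiction)
open import Relation.Binary.PropositionalEquality using (_≡_; _≢_; refl; sym; trans; cong; cong₂)
open import Relation.Binary.Construct.Closure.ReflexiveTransitive using (Star; ε; _◅_)

dirCycle-outArc : ∀ {n} (O : Orientation n) ((k , c , _ , arcs , last) : DirCycle O) →
                  (j : Fin (ℕ.suc k)) → ∃[ z ] O (c j) z ≡ true
dirCycle-outArc O (k , c , _ , arcs , last) j with view j
... | ‵fromℕ      = _ , last
... | ‵inject₁ i  = _ , arcs i

acyclic-reflect : ∀ {n} (O O′ : Orientation n) →
                  (∀ x y z → O′ x y ≡ true → O′ y z ≡ true → O x y ≡ true) →
                  Acyclic O → Acyclic O′
acyclic-reflect O O′ follow acyclic cycle@(k , c , injective , arcs , last) =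
  acyclic (k , c , injective ,
           (λ i → followOn (arcs i) (dirCycle-outArc O′ cycle (suc i))) ,
           followOn last (dirCycle-outArc O′ cycle zero))
  where
  followOn : ∀ {x y} → O′ x y ≡ true → ∃[ z ] O′ y z ≡ true → O x y ≡ true
  followOn xy (z , yz) = follow _ _ z xy yz

acyclic-⊆ : ∀ {n} (O O′ : Orientation n) →
            (∀ x y → O′ x y ≡ true → O x y ≡ true) → Acyclic O → Acyclic O′
acyclic-⊆ O O′ O′⊆O = acyclic-reflect O O′ (λ x y _ xy _ → O′⊆O x y xy)

acyclic⇒irreflexive : ∀ {n} (O : Orientation n) → Acyclic O → ∀ v → O v v ≡ false
acyclic⇒irreflexive O acyclic v with O v v in loop
... | false = refl
... | true  = contradiction selfLoop acyclic
  where
  selfLoop : DirCycle O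
  selfLoop = 0 , (λ _ → v) , (λ { {zero} {zero} _ → refl }) , (λ ()) , loop

flipAt-arc : ∀ {n} (P : Orientation n) v x y →
             flipAt v P x y ≡ true → y ≡ v ⊎ (P x y ≡ true × x ≢ v)
flipAt-arc P v x y xy with x ≟ v | y ≟ v | P x y
... | _      | yes y≡v | _    = inj₁ y≡v
... | no x≢v | no _    | true = inj₂ (refl , x≢v)
flipAt-arc P v x y () | yes _ | no _ | true
flipAt-arc P v x y () | _     | no _ | false

flipAt-sink : ∀ {n} (P : Orientation n) v → P v v ≡ false → ∀ y → flipAt v P v y ≡ false
flipAt-sink P v Pvv y with v ≟ v | y ≟ v
... | no v≢v | _     = contradiction refl v≢v
... | yes _  | no _  = cong (_∨ false) (∧-zeroʳ (P v y))
... | yes _  | yes _ = cong₂ _∨_ (∧-zeroʳ (P v y)) Pvv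

flipAt-acyclic : ∀ {n} (O P : Orientation n) v →
                 (∀ x y → x ≢ v → P x y ≡ true → O x y ≡ true) → P v v ≡ false →
                 Acyclic O → Acyclic (flipAt v P)
flipAt-acyclic O P v P⊆O Pvv = acyclic-reflect O (flipAt v P) follow
  where
  follow : ∀ x y z → flipAt v P x y ≡ true → flipAt v P y z ≡ true → O x y ≡ true
  follow x y z xy yz with flipAt-arc P v x y xy
  ... | inj₂ (Pxy , x≢v) = P⊆O x y x≢v Pxy
  ... | inj₁ refl with () ← trans (sym yz) (flipAt-sink P v Pvv z)

addArc-arc : ∀ {n} (O : Orientation n) w x x′ y →
             x′ ≢ w → addArc w x O x′ y ≡ true → O x′ y ≡ true
addArc-arc O w x x′ y x′≢w e with x′ ≟ w | O x′ y
... | yes x′≡w | _     = contradiction x′≡w x′≢w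
... | no _     | true  = refl
... | no _     | false = e

addArc-irreflexive : ∀ {n} (O : Orientation n) w x →
                     w ≢ x → O w w ≡ false → addArc w x O w w ≡ false
addArc-irreflexive O w x w≢x Oww with w ≟ x
... | yes w≡x = contradiction w≡x w≢x
... | no _    rewrite Oww with w ≟ w
...   | yes _ = refl
...   | no _  = refl

insert-acyclic : ∀ {n} (O : Orientation n) w x → w ≢ x →
                 Acyclic O → Acyclic (flipAt w (addArc w x O))
insert-acyclic O w x w≢x acyclic =
  flipAt-acyclic O (addArc w x O) w (addArc-arc O w x)
    (addArc-irreflexive O w x w≢x (acyclic⇒irreflexive O acyclic w)) acyclic

repair-acyclic : ∀ {n d} {O O′ : Orientation n} →
                 Star (RepairStep d) O O′ → Acyclic O → Acyclic O′
repair-acyclic ε acyclic = acyclic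
repair-acyclic {O = O} (repair v _ ◅ steps) acyclic =
  repair-acyclic steps
    (flipAt-acyclic O O v (λ _ _ _ Oxy → Oxy) (acyclic⇒irreflexive O acyclic v) acyclic)

removeEdge-acyclic : ∀ {n} (O : Orientation n) u v → Acyclic O → Acyclic (removeEdge u v O)
removeEdge-acyclic O u v = acyclic-⊆ O (removeEdge u v O) (λ x y → ∧-conicalˡ (O x y) _)

chosenEndpoints-distinct : ∀ {n} {u v w x : Fin n} → u ≢ v →
                           (w ≡ u × x ≡ v) ⊎ (w ≡ v × x ≡ u) → w ≢ x
chosenEndpoints-distinct u≢v (inj₁ (refl , refl)) = u≢v
chosenEndpoints-distinct u≢v (inj₂ (refl , refl)) = u≢v ∘ sym

run-acyclic : ∀ {n d α} {h : History n} {O : Orientation n} →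
              GoodHistory α h → Run d h O → Acyclic O
run-acyclic [] start (_ , _ , _ , _ , ())
run-acyclic ((_ ∷ good) _ _) (next {O = O} _ run (on-del u v)) =
  removeEdge-acyclic O u v (run-acyclic good run)
run-acyclic ((_ ∷ good) (u≢v , _) _) (next {O = O} _ run (on-ins _ _ w x chosen (steps , _))) =
  repair-acyclic steps
    (insert-acyclic O w x (chosenEndpoints-distinct u≢v chosen) (run-acyclic good run))

-- The arboricity bound and d > 2α only guarantee that repairing terminates;
-- acyclicity holds for every run.
lemma41 : (d α : ℕ) → 1 ≤ α → 2 * α < d →
    ∀ {n} (h : History n) → GoodHistory α h →
    (O : Orientation n) → Run d h O → Acyclic O
lemma41 _ _ _ _ _ good _ run = run-acyclic good run
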